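{- Let $G$ be a formula and let $\mathcal{D}$ be an $\mathbf{FRJ}(G)$-derivation of $G$. Then $\mathrm{Mod}(\mathcal D)$ is a countermodel for $G$, i.e. its root does not force $G$.
   Context: Formulas are built from a countably infinite set $\mathcal{V}$ of propositional variables and $\bot$ using $\land,\lor,\supset$. Let $\mathcal{V}_\bot=\mathcal{V}\cup\{\bot\}$, $\mathcal{L}^{\supset}$ the set of formulas with main connective $\supset$. For a formula $G$, $\mathrm{Sl}(G)$ and $\mathrm{Sr}(G)$ are the smallest subsets of the subformulas of $G$ with: $G\in\mathrm{Sr}(G)$; $A\land B$ or $A\lor B$ in $\mathrm{Sl}(G)$ (resp. $\mathrm{Sr}(G)$) implies $A,B$ in $\mathrm{Sl}(G)$ (resp. $\mathrm{Sr}(G)$); $A\supset B\in\mathrm{Sl}(G)$ implies $B\in\mathrm{Sl}(G)$, $A\in\mathrm{Sr}(G)$; $A\supset B\in\mathrm{Sr}(G)$ implies $B\in\mathrm{Sr}(G)$, $A\in\mathrm{Sl}(G)$. $\mathrm{Cl}(\Gamma)$ is the smallest set containing $\Gamma$ such that if $X,Y\in\mathrm{Cl}(\Gamma)$ and $A$ is any formula then $X\land Y,A\lor X,X\lor A,A\supset X\in\mathrm{Cl}(\Gamma)$. $\mathbf{FRJ}(G)$: let $\bar\Gamma^{At}=\mathrm{Sl}(G)\cap\mathcal V$, $\bar\Gamma^{\supset}=\mathrm{Sl}(G)\cap\mathcal L^{\supset}$, $\bar\Gamma=\bar\Gamma^{At}\cup\bar\Gamma^{\supset}$. Sequents: regular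 $\Gamma\Rightarrow C$ ($\Gamma\subseteq\bar\Gamma$, $C\in\mathrm{Sr}(G)$), irregular $\Sigma;\Theta\rightarrow C$ ($\Sigma\cup\Theta\subseteq\bar\Gamma$, $C\in\mathrm{Sr}(G)$); $\mathrm{Lhs}$ is $\Gamma$, resp. $\Sigma\cup\Theta$; conclusions always have right formula in $\mathrm{Sr}(G)$. Rules ($F\in\mathcal V_\bot$, $k\in\{1,2\}$): axioms $\bar\Gamma^{At}\setminus\{F\}\Rightarrow F$ and $\emptyset;(\bar\Gamma^{At}\setminus\{F\})\cup\bar\Gamma^{\supset}\rightarrow F$; ($\land$) $\Gamma\Rightarrow A_k/\Gamma\Rightarrow A_1\land A_2$ and $\Sigma;\Theta\rightarrow A_k/\Sigma;\Theta\rightarrow A_1\land A_2$; ($\lor$) $\Sigma_1;\Theta_1\rightarrow C_1$, $\Sigma_2;\Theta_2\rightarrow C_2 / \Sigma_1\cup\Sigma_2;\Theta_1\cap\Theta_2\rightarrow C_1\lor C_2$ if $\Sigma_1\subseteq\Sigma_2\cup\Theta_2$, $\Sigma_2\subseteq\Sigma_1\cup\Theta_1$; ($\supset_\in$) $\Gamma\Rightarrow B/\Gamma\Rightarrow A\supset B$ if $A\in\mathrm{Cl}(\Gamma)$, and $\Sigma;\Theta\cup\Lambda\rightarrow B/\Sigma\cup\Lambda;\Theta\rightarrow A\supset B$ if $\Theta\cap\Lambda=\emptyset$, $A\in\mathrm{Cl}(\Sigma\cup\Lambda)$ and no $\Lambda'\subsetneq\Lambda$ has $A\in\mathrm{Cl}(\Sigma\cup\Lambda')$;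 ($\supset_{\notin}$) $\Gamma\Rightarrow B/\emptyset;\Theta\rightarrow A\supset B$ if $\Theta\subseteq\mathrm{Cl}(\Gamma)\cap\bar\Gamma$, $A\in\mathrm{Cl}(\Gamma)\setminus\mathrm{Cl}(\Theta)$ and every $\Theta'$ with $\Theta\subsetneq\Theta'\subseteq\mathrm{Cl}(\Gamma)\cap\bar\Gamma$ has $A\in\mathrm{Cl}(\Theta')$; join rules with premises $\Sigma_j;\Theta_j\rightarrow A_j$ ($1\le j\le n$, $n\ge1$): let $\Upsilon=\{A_1,\dots,A_n\}$, $\Sigma^{At}=\bigcup_j(\Sigma_j\cap\mathcal V)$, $\Sigma^{\supset}=\bigcup_j(\Sigma_j\cap\mathcal L^{\supset})$, $\Theta^{At}=\bigcap_j(\Theta_j\cap\mathcal V)$, $\Theta^{\supset}=\{Y\supset Z\in\bigcap_j(\Theta_j\cap\mathcal L^{\supset}):Y\in\Upsilon\}$, requiring $\Sigma_i\subseteq\Sigma_j\cup\Theta_j$ ($i\ne j$) and ($Y\supset Z\in\Sigma^{\supset}\Rightarrow Y\in\Upsilon$); ($\bowtie^{At}$) conclusion $\Sigma^{At}\cup(\Theta^{At}\setminus\{F\})\cup\Sigma^{\supset}\cup\Theta^{\supset}\Rightarrow F$, $F\in\mathcal V_\bot\setminus\Sigma^{At}$, where each $Y\in\Upsilon$ has some $Y\supset Z\in\mathrm{Sl}(G)$; ($\bowtie^{\lor}$) conclusion $\Sigma^{At}\cup\Theta^{At}\cup\Sigma^{\supset}\cup\Theta^{\supset}\Rightarrow C_1\lor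 C_2$, $\{C_1,C_2\}\subseteq\Upsilon$, where each $Y\in\Upsilon$ has some $Y\supset Z\in\mathrm{Sl}(G)$ or $Y\lor Z\in\mathrm{Sr}(G)$ or $Z\lor Y\in\mathrm{Sr}(G)$. An $\mathbf{FRJ}(G)$-derivation of $G$ is a derivation (finite tree with axioms at leaves) of some regular sequent $\Gamma\Rightarrow G$. Write $\sigma_1\mapsto_0\sigma_2$ if some rule instance has conclusion $\sigma_2$ and $\sigma_1$ among its premises; $\mapsto_*$ is the reflexive-transitive closure. For a derivation $\mathcal D$ of $G$, a p-sequent is a regular sequent occurring in $\mathcal D$ that is an axiom or the conclusion of a join rule; $\mathrm{Mod}(\mathcal D)=(P,\le,\rho,V)$ where $P$ is the set of p-sequents of $\mathcal D$, $\sigma_1\le\sigma_2$ iff $\sigma_2\mapsto_*\sigma_1$, $\rho$ is the $\le$-minimum, and $V(\sigma)=\mathrm{Lhs}(\sigma)\cap\mathcal V$; this is a Kripke model with standard intuitionistic forcing. -}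

module Defs where

open import Data.Nat using (ℕ; suc)
open import Data.Fin using (Fin)
open import Data.List using (List; []; _∷_; _++_; tabulate)
open import Data.List.Membership.Propositional using (_∈_; _∉_)
open import Data.List.Relation.Binary.Subset.Propositional using (_⊆_)
open import Data.List.Relation.Unary.All using (All)
import Data.List.Relation.Unary.All as All
open import Data.Product using (Σ; ∃; ∃₂; _×_; _,_)
open import Data.Sum using (_⊎_)
open import Data.Empty using (⊥)
open import Data.Unit using (⊤)
open import Relation.Nullary using (¬_)
open import Relation.Binary.PropositionalEquality using (_≡_; _≢_)

infixr 6 _∧_
infixr 5 _∨_
infixr 4 _⊃_

data Formula : Set where
  var : ℕ → Formula
  ⊥f  : Formula
  _∧_ _∨_ _⊃_ : Formula → Formula → Formula

IsVar : Formula → Set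
IsVar (var _) = ⊤
IsVar _       = ⊥

IsImp : Formula → Set
IsImp (_ ⊃ _) = ⊤
IsImp _       = ⊥

IsVar⊥ : Formula → Set
IsVar⊥ (var _) = ⊤
IsVar⊥ ⊥f      = ⊤
IsVar⊥ _       = ⊥

data Sl (G : Formula) : Formula → Set
data Sr (G : Formula) : Formula → Set

data Sl G where
  sl-∧₁ : ∀ {A B} → Sl G (A ∧ B) → Sl G A
  sl-∧₂ : ∀ {A B} → Sl G (A ∧ B) → Sl G B
  sl-∨₁ : ∀ {A B} → Sl G (A ∨ B) → Sl G A
  sl-∨₂ : ∀ {A B} → Sl G (A ∨ B) → Sl G B
  sl-⊃  : ∀ {A B} → Sl G (A ⊃ B) → Sl G B
  sr-⊃l : ∀ {A B} → Sr G (A ⊃ B) → Sl G A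

data Sr G where
  sr-G  : Sr G G
  sr-∧₁ : ∀ {A B} → Sr G (A ∧ B) → Sr G A
  sr-∧₂ : ∀ {A B} → Sr G (A ∧ B) → Sr G B
  sr-∨₁ : ∀ {A B} → Sr G (A ∨ B) → Sr G A
  sr-∨₂ : ∀ {A B} → Sr G (A ∨ B) → Sr G B
  sr-⊃  : ∀ {A B} → Sr G (A ⊃ B) → Sr G B
  sl-⊃l : ∀ {A B} → Sl G (A ⊃ B) → Sr G A

-- Finite sets of formulas are represented by lists; only membership
-- matters everywhere below.

_≐_ : List Formula → (Formula → Set) → Set
xs ≐ P = ∀ x → (x ∈ xs → P x) × (P x → x ∈ xs)

_⊊_ : List Formula → List Formula → Set
xs ⊊ ys = xs ⊆ ys × ¬ (ys ⊆ xs)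

_≈L_ : List Formula → List Formula → Set
xs ≈L ys = xs ⊆ ys × ys ⊆ xs

data Cl (Γ : List Formula) : Formula → Set where
  cl-in : ∀ {X} → X ∈ Γ → Cl Γ X
  cl-∧  : ∀ {X Y} → Cl Γ X → Cl Γ Y → Cl Γ (X ∧ Y)
  cl-∨l : ∀ {A X} → Cl Γ X → Cl Γ (A ∨ X)
  cl-∨r : ∀ {A X} → Cl Γ X → Cl Γ (X ∨ A)
  cl-⊃  : ∀ {A X} → Cl Γ X → Cl Γ (A ⊃ X)

data Seq : Set where
  reg : List Formula → Formula → Seq
  irr : List Formula → List Formula → Formula → Seq

Lhs : Seq → List Formula
Lhs (reg Γ _)   = Γ
Lhs (irr S T _) = S ++ T

data _≈S_ : Seq → Seq → Set where
  reg≈ : ∀ {Γ Γ' C} → Γ ≈L Γ' → reg Γ C ≈S reg Γ' C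
  irr≈ : ∀ {S S' T T' C} → S ≈L S' → T ≈L T' → irr S T C ≈S irr S' T' C

module FRJ (G : Formula) where

  Γ̄At : Formula → Set
  Γ̄At x = Sl G x × IsVar x

  Γ̄⊃ : Formula → Set
  Γ̄⊃ x = Sl G x × IsImp x

  Γ̄ : Formula → Set
  Γ̄ x = Γ̄At x ⊎ Γ̄⊃ x

  WF : Seq → Set
  WF (reg Γ C)   = (∀ x → x ∈ Γ → Γ̄ x) × Sr G C
  WF (irr S T C) = (∀ x → x ∈ S → Γ̄ x) × (∀ x → x ∈ T → Γ̄ x) × Sr G C

  module Join (n : ℕ) (S T : Fin (suc n) → List Formula)
              (A : Fin (suc n) → Formula) where
    prems : List Seq
    prems = tabulate (λ j → irr (S j) (T j) (A j))

    Υ : Formula → Set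
    Υ Y = ∃ λ k → A k ≡ Y

    ΣAt : Formula → Set
    ΣAt x = IsVar x × ∃ λ j → x ∈ S j

    Σ⊃ : Formula → Set
    Σ⊃ x = IsImp x × ∃ λ j → x ∈ S j

    ΘAt : Formula → Set
    ΘAt x = IsVar x × (∀ j → x ∈ T j)

    Θ⊃ : Formula → Set
    Θ⊃ x = ∃₂ λ Y Z → x ≡ (Y ⊃ Z) × (∀ j → x ∈ T j) × Υ Y

    Side : Set
    Side = (∀ i j → i ≢ j → S i ⊆ (S j ++ T j))
         × (∀ j Y Z → (Y ⊃ Z) ∈ S j → Υ Y)

  data Rule : List Seq → Seq → Set where
    ax-reg : ∀ {Γ F} → IsVar⊥ F → Γ ≐ (λ x → Γ̄At x × x ≢ F) →
             Rule [] (reg Γ F)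
    ax-irr : ∀ {S T F} → IsVar⊥ F → S ≐ (λ _ → ⊥) →
             T ≐ (λ x → (Γ̄At x × x ≢ F) ⊎ Γ̄⊃ x) →
             Rule [] (irr S T F)
    ∧-reg₁ : ∀ {Γ Γ' A₁ A₂} → Γ' ≐ (_∈ Γ) →
             Rule (reg Γ A₁ ∷ []) (reg Γ' (A₁ ∧ A₂))
    ∧-reg₂ : ∀ {Γ Γ' A₁ A₂} → Γ' ≐ (_∈ Γ) →
             Rule (reg Γ A₂ ∷ []) (reg Γ' (A₁ ∧ A₂))
    ∧-irr₁ : ∀ {S T S' T' A₁ A₂} → S' ≐ (_∈ S) → T' ≐ (_∈ T) →
             Rule (irr S T A₁ ∷ []) (irr S' T' (A₁ ∧ A₂))
    ∧-irr₂ : ∀ {S T S' T' A₁ A₂} → S' ≐ (_∈ S) → T' ≐ (_∈ T) →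
             Rule (irr S T A₂ ∷ []) (irr S' T' (A₁ ∧ A₂))
    ∨-irr  : ∀ {S₁ T₁ C₁ S₂ T₂ C₂ S T} →
             S₁ ⊆ (S₂ ++ T₂) → S₂ ⊆ (S₁ ++ T₁) →
             S ≐ (λ x → x ∈ S₁ ⊎ x ∈ S₂) → T ≐ (λ x → x ∈ T₁ × x ∈ T₂) →
             Rule (irr S₁ T₁ C₁ ∷ irr S₂ T₂ C₂ ∷ []) (irr S T (C₁ ∨ C₂))
    ⊃∈-reg : ∀ {Γ Γ' A B} → Cl Γ A → Γ' ≐ (_∈ Γ) →
             Rule (reg Γ B ∷ []) (reg Γ' (A ⊃ B))
    ⊃∈-irr : ∀ {S T TΛ SΛ Λ A B} →
             TΛ ≐ (λ x → x ∈ T ⊎ x ∈ Λ) → SΛ ≐ (λ x → x ∈ S ⊎ x ∈ Λ) →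
             (∀ x → x ∈ T → x ∉ Λ) →
             Cl (S ++ Λ) A →
             (∀ Λ' → Λ' ⊊ Λ → ¬ Cl (S ++ Λ') A) →
             Rule (irr S TΛ B ∷ []) (irr SΛ T (A ⊃ B))
    ⊃∉     : ∀ {Γ S T A B} → S ≐ (λ _ → ⊥) →
             (∀ x → x ∈ T → Cl Γ x × Γ̄ x) →
             Cl Γ A → ¬ Cl T A →
             (∀ T' → T ⊊ T' → (∀ x → x ∈ T' → Cl Γ x × Γ̄ x) → Cl T' A) →
             Rule (reg Γ B ∷ []) (irr S T (A ⊃ B))
    ⋈At    : ∀ {n S T A Γ F} → let open Join n S T A in
             Side → IsVar⊥ F → ¬ ΣAt F →
             (∀ k → ∃ λ Z → Sl G (A k ⊃ Z)) →
             Γ ≐ (λ x → ΣAt x ⊎ (ΘAt x × x ≢ F) ⊎ Σ⊃ x ⊎ Θ⊃ x) →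
             Rule prems (reg Γ F)
    ⋈∨     : ∀ {n S T A Γ C₁ C₂} → let open Join n S T A in
             Side → Υ C₁ → Υ C₂ →
             (∀ k → (∃ λ Z → Sl G (A k ⊃ Z)) ⊎ (∃ λ Z → Sr G (A k ∨ Z))
                                              ⊎ (∃ λ Z → Sr G (Z ∨ A k))) →
             Γ ≐ (λ x → ΣAt x ⊎ ΘAt x ⊎ Σ⊃ x ⊎ Θ⊃ x) →
             Rule prems (reg Γ (C₁ ∨ C₂))

  Inst : List Seq → Seq → Set
  Inst ps c = Rule ps c × All WF ps × WF c

  data Deriv : Seq → Set where
    node : ∀ {ps c} → Rule ps c → All WF ps → WF c → All Deriv ps → Deriv c

  _↦₀_ : Seq → Seq → Set
  σ₁ ↦₀ σ₂ = ∃ λ ps → Inst ps σ₂ × σ₁ ∈ ps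

  data _↦*_ : Seq → Seq → Set where
    ε   : ∀ {σ₁ σ₂} → σ₁ ≈S σ₂ → σ₁ ↦* σ₂
    _◅_ : ∀ {σ₁ σ₂ σ₃} → σ₁ ↦₀ σ₂ → σ₂ ↦* σ₃ → σ₁ ↦* σ₃

  IsP : ∀ {ps c} → Rule ps c → Set
  IsP (ax-reg _ _)       = ⊤
  IsP (⋈At _ _ _ _ _)    = ⊤
  IsP (⋈∨ _ _ _ _ _)     = ⊤
  IsP _                  = ⊥

  data PSeq : ∀ {c} → Deriv c → Seq → Set where
    here  : ∀ {ps c} {r : Rule ps c} {wps wc} {ds : All Deriv ps} →
            IsP r → PSeq (node r wps wc ds) c
    there : ∀ {ps c σ c'} {r : Rule ps c} {wps wc} {ds : All Deriv ps} →
            (p : c' ∈ ps) → PSeq (All.lookup ds p) σ → PSeq (node r wps wc ds) σ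

  module Mod {c : Seq} (D : Deriv c) where
    P : Seq → Set
    P = PSeq D

    _≤_ : Seq → Seq → Set
    σ₁ ≤ σ₂ = σ₂ ↦* σ₁

    V : Seq → Formula → Set
    V σ x = x ∈ Lhs σ × IsVar x

    IsRoot : Seq → Set
    IsRoot ρ = P ρ × (∀ σ → P σ → ρ ≤ σ)

    _⊩_ : Seq → Formula → Set
    σ ⊩ var p   = V σ (var p)
    σ ⊩ ⊥f      = ⊥
    σ ⊩ (A ∧ B) = σ ⊩ A × σ ⊩ B
    σ ⊩ (A ∨ B) = σ ⊩ A ⊎ σ ⊩ B
    σ ⊩ (A ⊃ B) = ∀ σ' → P σ' → σ ≤ σ' → σ' ⊩ A → σ' ⊩ B

{-# OPTIONS --safe #-}
-- Mod(D) satisfies a truth lemma: a p-sequent w forces every formula of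
-- Cl(Lhs w).  Atoms and the closure clauses are immediate; an implication
-- Y ⊃ Z occurring in Lhs w is forced vacuously, because w is the conclusion of
-- a join rule with a premise whose right formula is Y, and that premise shows
-- that Y is not forced at w.  This refutation property holds for every sequent
-- of D by induction on the derivation: a regular sequent Γ ⇒ C is refuted at
-- its nearest p-sequent (the first one met going up through regular premises),
-- an irregular Σ;Θ → C at every p-sequent below it whose Lhs generates Σ; the
-- ⊃ rules use the truth lemma for the antecedent, so both statements are
-- proved together by induction on formulas.  The nearest p-sequent of the
-- end sequent Γ ⇒ G is the root of Mod(D), where G is therefore not forced.
module Submission where

open import Defs
open import Data.List using (List; []; _∷_; _++_; tabulate)
open import Data.List.Membership.Propositional using (_∈_)
open import Data.List.Membership.Propositional.Properties
  using (∈-++⁺ˡ; ∈-++⁺ʳ; ∈-++⁻; ∈-tabulate⁺; ∈-tabulate⁻)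
open import Data.List.Relation.Binary.Subset.Propositional using (_⊆_)
open import Data.List.Relation.Binary.Subset.Propositional.Properties
  using (⊆-refl; xs⊆xs++ys; xs⊆ys++xs; ++⁺)
open import Data.List.Relation.Unary.Any using (here; there)
open import Data.List.Relation.Unary.All using (All; []; _∷_)
import Data.List.Relation.Unary.All as All
open import Data.Product using (∃; _×_; _,_; proj₁; proj₂)
open import Data.Sum using (_⊎_; inj₁; inj₂; [_,_]′)
import Data.Sum as Sum
open import Data.Empty using (⊥-elim)
open import Data.Unit using (⊤; tt)
open import Function using (_∘_)
open import Data.Fin using (_≟_)
open import Relation.Nullary using (¬_; yes; no)
open import Relation.Binary.PropositionalEquality using (refl)
open import Relation.Binary.Construct.Closure.ReflexiveTransitive
  using (Star; ε; _◅_; _◅◅_)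

_⊆Cl_ : List Formula → List Formula → Set
Γ ⊆Cl Δ = ∀ {x} → x ∈ Γ → Cl Δ x

⊆⇒⊆Cl : ∀ {Γ Δ} → Γ ⊆ Δ → Γ ⊆Cl Δ
⊆⇒⊆Cl Γ⊆Δ = cl-in ∘ Γ⊆Δ

Cl-trans : ∀ {Γ Δ X} → Γ ⊆Cl Δ → Cl Γ X → Cl Δ X
Cl-trans h (cl-in m)  = h m
Cl-trans h (cl-∧ a b) = cl-∧ (Cl-trans h a) (Cl-trans h b)
Cl-trans h (cl-∨l a)  = cl-∨l (Cl-trans h a)
Cl-trans h (cl-∨r a)  = cl-∨r (Cl-trans h a)
Cl-trans h (cl-⊃ a)   = cl-⊃ (Cl-trans h a)

⊆Cl-trans : ∀ {Γ Δ Ε} → Γ ⊆Cl Δ → Δ ⊆Cl Ε → Γ ⊆Cl Ε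
⊆Cl-trans f g = Cl-trans g ∘ f

Cl-atom : ∀ {Γ F} → IsVar⊥ F → Cl Γ F → F ∈ Γ
Cl-atom {F = var _} _ (cl-in m) = m
Cl-atom {F = ⊥f}    _ (cl-in m) = m

IsVar⊥⇒¬IsImp : ∀ {F} → IsVar⊥ F → ¬ IsImp F
IsVar⊥⇒¬IsImp {var _} _ ()

++-⊆ : ∀ {xs ys zs : List Formula} → xs ⊆ zs → ys ⊆ zs → xs ++ ys ⊆ zs
++-⊆ {xs} f g = [ f , g ]′ ∘ ∈-++⁻ xs

∈-≐⁻ : ∀ {xs P x} → xs ≐ P → x ∈ xs → P x
∈-≐⁻ e = proj₁ (e _)

∈-≐⁺ : ∀ {xs P x} → xs ≐ P → P x → x ∈ xs
∈-≐⁺ e = proj₂ (e _)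

≈S-refl : ∀ {σ} → σ ≈S σ
≈S-refl {reg _ _}   = reg≈ (⊆-refl , ⊆-refl)
≈S-refl {irr _ _ _} = irr≈ (⊆-refl , ⊆-refl) (⊆-refl , ⊆-refl)

≈S-Lhs : ∀ {σ τ} → σ ≈S τ → Lhs τ ⊆ Lhs σ
≈S-Lhs (reg≈ (_ , Γ'⊆Γ)) = Γ'⊆Γ
≈S-Lhs (irr≈ (_ , S'⊆S) (_ , T'⊆T)) = ++⁺ S'⊆S T'⊆T

mutual
  Hered : (Formula → Set) → Formula → Set
  Hered Q X = Q X × Below Q X

  Below : (Formula → Set) → Formula → Set
  Below Q (var _) = ⊤
  Below Q ⊥f      = ⊤
  Below Q (A ∧ B) = Hered Q A × Hered Q B
  Below Q (A ∨ B) = Hered Q A × Hered Q B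
  Below Q (A ⊃ B) = Hered Q A × Hered Q B

module _ {Q : Formula → Set} (step : ∀ X → Below Q X → Q X) where
  mutual
    hered : ∀ X → Hered Q X
    hered X = step X (below X) , below X

    below : ∀ X → Below Q X
    below (var _) = tt
    below ⊥f      = tt
    below (A ∧ B) = hered A , hered B
    below (A ∨ B) = hered A , hered B
    below (A ⊃ B) = hered A , hered B

module FRJProperties (G : Formula) where
  open FRJ G

  -- The reflexive case of _↦*_ is only up to ≈S, so _↦*_ is not transitive;
  -- paths are composed in Star _↦₀_ and converted at the end.
  _↝_ : Seq → Seq → Set
  _↝_ = Star _↦₀_

  ↦*-refl : ∀ {σ} → σ ↦* σ
  ↦*-refl = ε ≈S-refl

  _◅◅↦*_ : ∀ {σ τ ρ} → σ ↝ τ → τ ↦* ρ → σ ↦* ρ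
  ε        ◅◅↦* q = q
  (s ◅ ss) ◅◅↦* q = s ◅ (ss ◅◅↦* q)

  ↝⇒↦* : ∀ {σ τ} → σ ↝ τ → σ ↦* τ
  ↝⇒↦* p = p ◅◅↦* ↦*-refl

  premise-step : ∀ {ps c σ} → Rule ps c → All WF ps → WF c → σ ∈ ps → σ ↦₀ c
  premise-step r wps wc p = _ , (r , wps , wc) , p

  JoinLhs : ∀ n S T A → Formula → Set
  JoinLhs n S T A x = ΣAt x ⊎ ΘAt x ⊎ Σ⊃ x ⊎ Θ⊃ x
    where open Join n S T A

  module _ {n S T A} (side : Join.Side n S T A) where
    open Join n S T A

    join-S-⊆ : ∀ i j {x} → x ∈ S i → x ∈ S j ++ T j
    join-S-⊆ i j with i ≟ j
    ... | yes refl = ∈-++⁺ˡ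
    ... | no i≢j   = proj₁ side i j i≢j

    join-lhs-⊆ : ∀ {x} → JoinLhs n S T A x → ∀ j → x ∈ S j ++ T j
    join-lhs-⊆ (inj₁ (_ , i , m))                 j = join-S-⊆ i j m
    join-lhs-⊆ (inj₂ (inj₁ (_ , m)))               j = ∈-++⁺ʳ (S j) (m j)
    join-lhs-⊆ (inj₂ (inj₂ (inj₁ (_ , i , m))))    j = join-S-⊆ i j m
    join-lhs-⊆ (inj₂ (inj₂ (inj₂ (_ , _ , _ , m , _)))) j = ∈-++⁺ʳ (S j) (m j)

    join-lhs-antecedent : ∀ {Y Z} → JoinLhs n S T A (Y ⊃ Z) → Υ Y
    join-lhs-antecedent (inj₁ (() , _))
    join-lhs-antecedent (inj₂ (inj₁ (() , _)))
    join-lhs-antecedent (inj₂ (inj₂ (inj₁ (_ , j , m)))) = proj₂ side j _ _ m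
    join-lhs-antecedent (inj₂ (inj₂ (inj₂ (_ , _ , refl , _ , y)))) = y

  premise-Σ : ∀ {n S T A} k {x} → WF (irr (S k) (T k) (A k)) → x ∈ S k →
              Join.ΣAt n S T A x ⊎ Join.Σ⊃ n S T A x
  premise-Σ k (S⊆ , _) m with S⊆ _ m
  ... | inj₁ (_ , isVar) = inj₁ (isVar , k , m)
  ... | inj₂ (_ , isImp) = inj₂ (isImp , k , m)

  premise-Lhs : ∀ {ps c σ} → Rule ps c → σ ∈ ps → Lhs c ⊆Cl Lhs σ
  premise-Lhs (∧-reg₁ dΓ) (here refl) = ⊆⇒⊆Cl (∈-≐⁻ dΓ)
  premise-Lhs (∧-reg₂ dΓ) (here refl) = ⊆⇒⊆Cl (∈-≐⁻ dΓ)
  premise-Lhs (⊃∈-reg _ dΓ) (here refl) = ⊆⇒⊆Cl (∈-≐⁻ dΓ)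
  premise-Lhs (∧-irr₁ dS dT) (here refl) = ⊆⇒⊆Cl (++⁺ (∈-≐⁻ dS) (∈-≐⁻ dT))
  premise-Lhs (∧-irr₂ dS dT) (here refl) = ⊆⇒⊆Cl (++⁺ (∈-≐⁻ dS) (∈-≐⁻ dT))
  premise-Lhs (∨-irr {S₁ = S₁} {T₁} _ S₂⊆ dS dT) (here refl) = ⊆⇒⊆Cl (++-⊆
    ([ xs⊆xs++ys S₁ T₁ , S₂⊆ ]′ ∘ ∈-≐⁻ dS)
    (xs⊆ys++xs T₁ S₁ ∘ proj₁ ∘ ∈-≐⁻ dT))
  premise-Lhs (∨-irr {S₂ = S₂} {T₂ = T₂} S₁⊆ _ dS dT) (there (here refl)) =
    ⊆⇒⊆Cl (++-⊆
    ([ S₁⊆ , xs⊆xs++ys S₂ T₂ ]′ ∘ ∈-≐⁻ dS)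
    (xs⊆ys++xs T₂ S₂ ∘ proj₂ ∘ ∈-≐⁻ dT))
  premise-Lhs (⊃∈-irr {S = S} {TΛ = TΛ} dTΛ dSΛ _ _ _) (here refl) = ⊆⇒⊆Cl (++-⊆
    ([ xs⊆xs++ys S TΛ , xs⊆ys++xs TΛ S ∘ ∈-≐⁺ dTΛ ∘ inj₂ ]′ ∘ ∈-≐⁻ dSΛ)
    (xs⊆ys++xs TΛ S ∘ ∈-≐⁺ dTΛ ∘ inj₁))
  premise-Lhs (⊃∉ {S = S} dS T⊆ _ _ _) (here refl) {x} m with ∈-++⁻ S m
  ... | inj₁ x∈S = ⊥-elim (∈-≐⁻ dS x∈S)
  ... | inj₂ x∈T = proj₁ (T⊆ x x∈T)
  premise-Lhs (⋈At {S = S} {T} {A} side _ _ _ dΓ) m x∈Γ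
    with ∈-tabulate⁻ {f = λ j → irr (S j) (T j) (A j)} m
  ... | j , refl =
    cl-in (join-lhs-⊆ side (Sum.map₂ (Sum.map₁ proj₁) (∈-≐⁻ dΓ x∈Γ)) j)
  premise-Lhs (⋈∨ {S = S} {T} {A} side _ _ _ dΓ) m x∈Γ
    with ∈-tabulate⁻ {f = λ j → irr (S j) (T j) (A j)} m
  ... | j , refl = cl-in (join-lhs-⊆ side (∈-≐⁻ dΓ x∈Γ) j)

  ↦*-Lhs : ∀ {σ τ} → σ ↦* τ → Lhs τ ⊆Cl Lhs σ
  ↦*-Lhs (ε σ≈τ)                   = ⊆⇒⊆Cl (≈S-Lhs σ≈τ)
  ↦*-Lhs ((_ , (r , _) , p) ◅ rest) = ⊆Cl-trans (↦*-Lhs rest) (premise-Lhs r p)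

  ↝-Lhs : ∀ {σ τ} → σ ↝ τ → Lhs τ ⊆Cl Lhs σ
  ↝-Lhs = ↦*-Lhs ∘ ↝⇒↦*

  PSeq-↝ : ∀ {c σ} (d : Deriv c) → PSeq d σ → σ ↝ c
  PSeq-↝ (node _ _ _ _)     (here _)    = ε
  PSeq-↝ (node r wps wc ds) (there p q) =
    PSeq-↝ (All.lookup ds p) q ◅◅ premise-step r wps wc p ◅ ε

  PSeq-WF : ∀ {c σ} (d : Deriv c) → PSeq d σ → WF σ
  PSeq-WF (node _ _ wc _)  (here _)    = wc
  PSeq-WF (node _ _ _ ds)  (there p q) = PSeq-WF (All.lookup ds p) q

  WF-Lhs : ∀ {σ x} → WF σ → x ∈ Lhs σ → Γ̄ x
  WF-Lhs {reg _ _}   (Γ⊆ , _) = Γ⊆ _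
  WF-Lhs {irr S _ _} (S⊆ , T⊆ , _) m = [ S⊆ _ , T⊆ _ ]′ (∈-++⁻ S m)

  record NearestP {Γ C} (d : Deriv (reg Γ C)) : Set where
    field
      pseq   : Seq
      pseq∈  : PSeq d pseq
      pseq↝  : pseq ↝ reg Γ C
      ↝pseq  : ∀ {σ} → PSeq d σ → σ ↝ pseq

  nearest-self : ∀ {Γ C} (d : Deriv (reg Γ C)) → PSeq d (reg Γ C) → NearestP d
  nearest-self {Γ} {C} d here-p = record
    { pseq = reg Γ C ; pseq∈ = here-p ; pseq↝ = ε ; ↝pseq = PSeq-↝ d }

  nearest-premise : ∀ {Γ C Γ' C'} {r : Rule (reg Γ' C' ∷ []) (reg Γ C)} {wps wc}
                    {d : Deriv (reg Γ' C')} → ¬ IsP r → NearestP d →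
                    NearestP (node r wps wc (d ∷ []))
  nearest-premise {r = r} {wps} {wc} notP n = record
    { pseq  = pseq
    ; pseq∈ = there (here refl) pseq∈
    ; pseq↝ = pseq↝ ◅◅ premise-step r wps wc (here refl) ◅ ε
    ; ↝pseq = λ { (here isP) → ⊥-elim (notP isP) ; (there (here refl) q) → ↝pseq q }
    }
    where open NearestP n

  nearestP : ∀ {Γ C} (d : Deriv (reg Γ C)) → NearestP d
  nearestP d@(node (ax-reg _ _) _ _ _)       = nearest-self d (here tt)
  nearestP d@(node (⋈At _ _ _ _ _) _ _ _)    = nearest-self d (here tt)
  nearestP d@(node (⋈∨ _ _ _ _ _) _ _ _)     = nearest-self d (here tt)
  nearestP (node (∧-reg₁ _) _ _ (d ∷ []))   = nearest-premise (λ ()) (nearestP d)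
  nearestP (node (∧-reg₂ _) _ _ (d ∷ []))   = nearest-premise (λ ()) (nearestP d)
  nearestP (node (⊃∈-reg _ _) _ _ (d ∷ [])) = nearest-premise (λ ()) (nearestP d)

module Countermodel (G : Formula) (Γ₀ : List Formula) (D : FRJ.Deriv G (reg Γ₀ G)) where
  open FRJ G
  open Mod D
  open FRJProperties G

  Embedded : ∀ {c} → Deriv c → Set
  Embedded d = ∀ {σ} → PSeq d σ → P σ

  EmbeddedAll : ∀ {ps} → All Deriv ps → Set
  EmbeddedAll {ps} ds = ∀ {q} (p : q ∈ ps) → Embedded (All.lookup ds p)

  premises-embedded : ∀ {ps c} {r : Rule ps c} {wps wc ds} →
                      Embedded (node r wps wc ds) → EmbeddedAll ds
  premises-embedded e p = e ∘ there p

  forces-atom : ∀ {F u} → IsVar⊥ F → u ⊩ F → F ∈ Lhs u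
  forces-atom {var _} _ (m , _) = m

  Truth : Formula → Set
  Truth X = ∀ w → P w → Cl (Lhs w) X → w ⊩ X

  -- u ranges over the worlds equivalent to v in Mod(D), such as its root.
  RegRefuted : Seq → Formula → Set
  RegRefuted v C = ∀ u → P u → v ↦* u → u ↦* v → ¬ u ⊩ C

  IrrRefuted : List Formula → List Formula → Formula → Set
  IrrRefuted S T C = ∀ u → P u → irr S T C ↦* u → S ⊆Cl Lhs u → ¬ u ⊩ C

  reached-atom : ∀ {F v u} → IsVar⊥ F → v ↦* u → u ⊩ F → F ∈ Lhs v
  reached-atom fv v↦u = Cl-atom fv ∘ ↦*-Lhs v↦u ∘ forces-atom fv

  mutual
    refute-irr : ∀ {S T C} (d : Deriv (irr S T C)) → Embedded d → Below Truth C →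
                 IrrRefuted S T C
    refute-irr (node (ax-irr {S} fv dS dT) _ _ _) _ _ u _ c↦u _ ⊩F
      with ∈-++⁻ S (reached-atom fv c↦u ⊩F)
    ... | inj₁ F∈S = ∈-≐⁻ dS F∈S
    ... | inj₂ F∈T with ∈-≐⁻ dT F∈T
    ...   | inj₁ (_ , F≢F)   = F≢F refl
    ...   | inj₂ (_ , isImp) = IsVar⊥⇒¬IsImp fv isImp
    refute-irr (node r@(∧-irr₁ dS _) wps wc ds) e ((_ , b₁) , _)
               u Pu c↦u S⊆u (⊩A₁ , _) =
      refute-above r wps wc ds e (here refl) b₁ u Pu c↦u (S⊆u ∘ ∈-≐⁺ dS) ⊩A₁
    refute-irr (node r@(∧-irr₂ dS _) wps wc ds) e (_ , (_ , b₂))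
               u Pu c↦u S⊆u (_ , ⊩A₂) =
      refute-above r wps wc ds e (here refl) b₂ u Pu c↦u (S⊆u ∘ ∈-≐⁺ dS) ⊩A₂
    refute-irr (node r@(∨-irr _ _ dS _) wps wc ds) e ((_ , b₁) , _)
               u Pu c↦u S⊆u (inj₁ ⊩C₁) =
      refute-above r wps wc ds e (here refl) b₁ u Pu c↦u
        (S⊆u ∘ ∈-≐⁺ dS ∘ inj₁) ⊩C₁
    refute-irr (node r@(∨-irr _ _ dS _) wps wc ds) e (_ , (_ , b₂))
               u Pu c↦u S⊆u (inj₂ ⊩C₂) =
      refute-above r wps wc ds e (there (here refl)) b₂ u Pu c↦u
        (S⊆u ∘ ∈-≐⁺ dS ∘ inj₂) ⊩C₂
    refute-irr (node r@(⊃∈-irr {S = S} {SΛ = SΛ} {Λ} _ dSΛ _ cA _) wps wc ds) e ((tA , _) , (_ , bB))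
               u Pu c↦u SΛ⊆u ⊩A⊃B =
      refute-above r wps wc ds e (here refl) bB u Pu c↦u
        (SΛ⊆u ∘ ∈-≐⁺ dSΛ ∘ inj₁)
        (⊩A⊃B u Pu ↦*-refl (tA u Pu (Cl-trans (SΛ⊆u ∘ SΛ⊇) cA)))
      where
      SΛ⊇ : S ++ Λ ⊆ SΛ
      SΛ⊇ = ++-⊆ (∈-≐⁺ dSΛ ∘ inj₁) (∈-≐⁺ dSΛ ∘ inj₂)
    refute-irr (node r@(⊃∉ _ _ cA _ _) wps wc (d ∷ [])) e ((tA , _) , (_ , bB))
               u Pu c↦u _ ⊩A⊃B =
      refute-reg d (premises-embedded e (here refl)) bB pseq Pv ↦*-refl ↦*-refl
        (⊩A⊃B pseq Pv v↦u (tA pseq Pv (Cl-trans (↝-Lhs pseq↝) cA)))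
      where
      open NearestP (nearestP d)
      Pv : P pseq
      Pv = premises-embedded e (here refl) pseq∈
      v↦u : pseq ↦* u
      v↦u = pseq↝ ◅◅↦* (premise-step r wps wc (here refl) ◅ c↦u)

    refute-reg : ∀ {Γ C} (d : Deriv (reg Γ C)) → Embedded d → Below Truth C →
                 RegRefuted (NearestP.pseq (nearestP d)) C
    refute-reg (node (ax-reg fv dΓ) _ _ _) _ _ u _ v↦u _ ⊩F =
      proj₂ (∈-≐⁻ dΓ (reached-atom fv v↦u ⊩F)) refl
    refute-reg (node (⋈At _ fv F∉Σ _ dΓ) _ _ _) _ _ u _ v↦u _ ⊩F
      with ∈-≐⁻ dΓ (reached-atom fv v↦u ⊩F)
    ... | inj₁ F∈Σ                              = F∉Σ F∈Σ
    ... | inj₂ (inj₁ (_ , F≢F))                 = F≢F refl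
    ... | inj₂ (inj₂ (inj₁ (isImp , _)))        = IsVar⊥⇒¬IsImp fv isImp
    ... | inj₂ (inj₂ (inj₂ (_ , _ , refl , _))) = fv
    refute-reg (node r@(⋈∨ {S = S} {T} {A} _ (k₁ , refl) (k₂ , refl) _ dΓ) wps wc ds) e
               ((_ , b₁) , (_ , b₂)) u Pu c↦u u↦c =
      [ refute k₁ b₁ , refute k₂ b₂ ]′
      where
      refute : ∀ k → Below Truth (A k) → ¬ u ⊩ A k
      refute k b = join-premise-refuted {S = S} {T} {A} r wps wc ds e
                     (∈-≐⁺ dΓ ∘ [ inj₁ , inj₂ ∘ inj₂ ∘ inj₁ ]′) k b u Pu c↦u u↦c
    refute-reg (node (∧-reg₁ _) _ _ (d ∷ [])) e ((_ , b₁) , _) u Pu v↦u u↦v (⊩A₁ , _) =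
      refute-reg d (premises-embedded e (here refl)) b₁ u Pu v↦u u↦v ⊩A₁
    refute-reg (node (∧-reg₂ _) _ _ (d ∷ [])) e (_ , (_ , b₂)) u Pu v↦u u↦v (_ , ⊩A₂) =
      refute-reg d (premises-embedded e (here refl)) b₂ u Pu v↦u u↦v ⊩A₂
    refute-reg (node (⊃∈-reg {Γ} cA _) _ _ (d ∷ [])) e ((tA , _) , (_ , bB))
               u Pu v↦u u↦v ⊩A⊃B =
      refute-reg d (premises-embedded e (here refl)) bB u Pu v↦u u↦v
        (⊩A⊃B u Pu ↦*-refl (tA u Pu (Cl-trans Γ⊆u cA)))
      where
      open NearestP (nearestP d)
      Γ⊆u : Γ ⊆Cl Lhs u
      Γ⊆u = ⊆Cl-trans (↝-Lhs pseq↝) (↦*-Lhs u↦v)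

    refute-premise : ∀ {ps} (ds : All Deriv ps) → EmbeddedAll ds →
                     ∀ {S T C} → irr S T C ∈ ps → Below Truth C → IrrRefuted S T C
    refute-premise (d ∷ _)  e (here refl) = refute-irr d (e (here refl))
    refute-premise (_ ∷ ds) e (there p)   = refute-premise ds (e ∘ there) p

    refute-above : ∀ {ps c S T C} (r : Rule ps c) wps wc (ds : All Deriv ps) →
                   Embedded (node r wps wc ds) → irr S T C ∈ ps → Below Truth C →
                   ∀ u → P u → c ↦* u → S ⊆Cl Lhs u → ¬ u ⊩ C
    refute-above r wps wc ds e p b u Pu c↦u =
      refute-premise ds (premises-embedded e) p b u Pu (premise-step r wps wc p ◅ c↦u)

    join-premise-refuted :
      ∀ {n S T A Γ C} (r : Rule (Join.prems n S T A) (reg Γ C)) wps wc ds →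
      Embedded (node r wps wc ds) →
      (∀ {x} → Join.ΣAt n S T A x ⊎ Join.Σ⊃ n S T A x → x ∈ Γ) →
      ∀ k → Below Truth (A k) → RegRefuted (reg Γ C) (A k)
    join-premise-refuted {n} {S} {T} {A} {Γ} r wps wc ds e Σ⊆Γ k b u Pu c↦u u↦c =
      refute-above r wps wc ds e p b u Pu c↦u (⊆Cl-trans Sk⊆Γ (↦*-Lhs u↦c))
      where
      p : irr (S k) (T k) (A k) ∈ Join.prems n S T A
      p = ∈-tabulate⁺ {f = λ j → irr (S j) (T j) (A j)} k
      Sk⊆Γ : S k ⊆Cl Γ
      Sk⊆Γ = ⊆⇒⊆Cl (Σ⊆Γ ∘ premise-Σ {S = S} {T} {A} k (All.lookup wps p))

  antecedent-refuted : ∀ {c σ Y Z} (d : Deriv c) → Embedded d → PSeq d σ →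
                       (Y ⊃ Z) ∈ Lhs σ → Below Truth Y → ¬ σ ⊩ Y
  antecedent-refuted (node _ _ _ ds) e (there p q) =
    antecedent-refuted (All.lookup ds p) (premises-embedded e p) q
  antecedent-refuted (node (ax-reg _ dΓ) _ _ _) _ (here _) m =
    ⊥-elim (proj₂ (proj₁ (∈-≐⁻ dΓ m)))
  antecedent-refuted (node r@(⋈At {S = S} {T} {A} side _ _ _ dΓ) wps wc ds) e (here _) m b ⊩Y
    with join-lhs-antecedent side (Sum.map₂ (Sum.map₁ proj₁) (∈-≐⁻ dΓ m))
  ... | k , refl =
    join-premise-refuted {S = S} {T} {A} r wps wc ds e
      (∈-≐⁺ dΓ ∘ [ inj₁ , inj₂ ∘ inj₂ ∘ inj₁ ]′) k b _ (e (here tt))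
      ↦*-refl ↦*-refl ⊩Y
  antecedent-refuted (node r@(⋈∨ {S = S} {T} {A} side _ _ _ dΓ) wps wc ds) e (here _) m b ⊩Y
    with join-lhs-antecedent side (∈-≐⁻ dΓ m)
  ... | k , refl =
    join-premise-refuted {S = S} {T} {A} r wps wc ds e
      (∈-≐⁺ dΓ ∘ [ inj₁ , inj₂ ∘ inj₂ ∘ inj₁ ]′) k b _ (e (here tt))
      ↦*-refl ↦*-refl ⊩Y
  antecedent-refuted (node (ax-irr _ _ _) _ _ _)     _ (here ())
  antecedent-refuted (node (∧-reg₁ _) _ _ _)         _ (here ())
  antecedent-refuted (node (∧-reg₂ _) _ _ _)         _ (here ())
  antecedent-refuted (node (∧-irr₁ _ _) _ _ _)       _ (here ())
  antecedent-refuted (node (∧-irr₂ _ _) _ _ _)       _ (here ())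
  antecedent-refuted (node (∨-irr _ _ _ _) _ _ _)    _ (here ())
  antecedent-refuted (node (⊃∈-reg _ _) _ _ _)       _ (here ())
  antecedent-refuted (node (⊃∈-irr _ _ _ _ _) _ _ _) _ (here ())
  antecedent-refuted (node (⊃∉ _ _ _ _ _) _ _ _)     _ (here ())

  Lhs-var-or-imp : ∀ {w x} → P w → x ∈ Lhs w → IsVar x ⊎ IsImp x
  Lhs-var-or-imp Pw = Sum.map proj₂ proj₂ ∘ WF-Lhs (PSeq-WF D Pw)

  truth-step : ∀ X → Below Truth X → Truth X
  truth-step (var _) _ w Pw c = Cl-atom tt c , tt
  truth-step ⊥f _ w Pw c = [ (λ ()) , (λ ()) ]′ (Lhs-var-or-imp Pw (Cl-atom tt c))
  truth-step (A ∧ B) _ w Pw (cl-in m) = ⊥-elim ([ (λ ()) , (λ ()) ]′ (Lhs-var-or-imp Pw m))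
  truth-step (A ∧ B) ((tA , _) , (tB , _)) w Pw (cl-∧ a b) = tA w Pw a , tB w Pw b
  truth-step (A ∨ B) _ w Pw (cl-in m) = ⊥-elim ([ (λ ()) , (λ ()) ]′ (Lhs-var-or-imp Pw m))
  truth-step (A ∨ B) ((tA , _) , _) w Pw (cl-∨r a) = inj₁ (tA w Pw a)
  truth-step (A ∨ B) (_ , (tB , _)) w Pw (cl-∨l b) = inj₂ (tB w Pw b)
  truth-step (Y ⊃ Z) ((_ , bY) , (tZ , _)) w Pw c w′ Pw′ w≤w′ ⊩Y
    with Cl-trans (↦*-Lhs w≤w′) c
  ... | cl-⊃ cZ = tZ w′ Pw′ cZ
  ... | cl-in m = ⊥-elim (antecedent-refuted D (λ q → q) Pw′ m bY ⊩Y)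

theorem3p10 : (G : Formula) (Γ : List Formula) (D : FRJ.Deriv G (reg Γ G)) →
    (∃ λ ρ → FRJ.Mod.IsRoot G D ρ)
    × (∀ ρ → FRJ.Mod.IsRoot G D ρ → ¬ (FRJ.Mod._⊩_ G D ρ G))
theorem3p10 G Γ D = (pseq , pseq∈ , λ σ Pσ → ↝⇒↦* (↝pseq Pσ)) , root-refutes-G
  where
  open FRJ G
  open Mod D
  open FRJProperties G
  open Countermodel G Γ D
  open NearestP (nearestP D)

  root-refutes-G : ∀ ρ → IsRoot ρ → ¬ ρ ⊩ G
  root-refutes-G ρ (Pρ , ρ≤) = refute-reg D (λ q → q) (below truth-step G) ρ Pρ
                                 (ρ≤ pseq pseq∈) (↝⇒↦* (↝pseq Pρ))
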